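{- Let $\tilde\alpha,\tilde\beta:\mathbb{Q}^3\to\mathbb{Q}^3$ be the bijections $\tilde\alpha(x,y,z)=(x,z,xz-y)$ and $\tilde\beta(x,y,z)=(y,z,x)$, let $\widetilde G=\langle\tilde\alpha,\tilde\beta\rangle$, and let $\widetilde T(X,Y,Z)=XYZ-X^2-Y^2-Z^2-7$. Then the set of positive integer solutions of $\widetilde T(X,Y,Z)=0$ is exactly the orbit of $(3,4,4)$ under $\widetilde G$: $$\widetilde G(3,4,4)=\{(x,y,z)\in\mathbb{N}^3\mid \widetilde T(x,y,z)=0\}.$$
   Context: $\mathbb{N}$ denotes the positive integers; $\widetilde G(3,4,4)=\{\tilde g(3,4,4)\mid \tilde g\in\widetilde G\}$. -}

module Defs where

open import Data.Nat as ℕ using (ℕ)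
open import Data.Integer using (+_)
open import Data.Rational using (ℚ; _+_; _-_; _*_; 0ℚ; _/_)
open import Data.Product using (_×_; _,_; ∃-syntax)
open import Relation.Binary.PropositionalEquality using (_≡_)

ℚ³ : Set
ℚ³ = ℚ × ℚ × ℚ

α̃ : ℚ³ → ℚ³
α̃ (x , y , z) = (x , z , x * z - y)

β̃ : ℚ³ → ℚ³
β̃ (x , y , z) = (y , z , x)

-- The orbit is the smallest set containing p₀ and
-- closed under α̃, β̃ and their inverses; closure under an inverse g⁻¹
-- is expressed as: if g q is in the orbit then so is q.
data Orbit (p₀ : ℚ³) : ℚ³ → Set where
  base : Orbit p₀ p₀
  by-α   : ∀ {q} → Orbit p₀ q → Orbit p₀ (α̃ q)
  by-β   : ∀ {q} → Orbit p₀ q → Orbit p₀ (β̃ q)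
  by-α⁻¹ : ∀ {q} → Orbit p₀ (α̃ q) → Orbit p₀ q
  by-β⁻¹ : ∀ {q} → Orbit p₀ (β̃ q) → Orbit p₀ q

⟦_⟧ : ℕ → ℚ
⟦ n ⟧ = (+ n) / 1

T̃ : ℚ → ℚ → ℚ → ℚ
T̃ x y z = x * y * z - x * x - y * y - z * z - ⟦ 7 ⟧

PosSol : ℚ³ → Set
PosSol p = ∃[ x ] ∃[ y ] ∃[ z ]
  (1 ℕ.≤ x × 1 ℕ.≤ y × 1 ℕ.≤ z ×
   p ≡ (⟦ x ⟧ , ⟦ y ⟧ , ⟦ z ⟧) × T̃ ⟦ x ⟧ ⟦ y ⟧ ⟦ z ⟧ ≡ 0ℚ)

-- Over ℕ the equation xyz = x² + y² + z² + 7 has no solutions with a zero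
-- coordinate, and its solution set is preserved by rotating the coordinates,
-- by swapping the last two, and by the Vieta move y ↦ xz − y (the other root
-- of the equation as a quadratic in y), which is α̃ up to that swap.  As
-- α̃⁻¹ = σ̃ α̃ σ̃ for the swap σ̃, the whole orbit of (3,4,4) consists of solutions.
-- Conversely, rotate a solution so that its largest coordinate y is in the
-- middle.  If the Vieta partner w = xz − y is smaller than y, then α̃ maps the
-- solution to one of smaller height x + y + z; otherwise the relations
-- y + w = xz and yw = x² + z² + 7 with y ≤ w pin the triple down to (3,4,4)
-- or (4,4,3).  Induction on the height finishes the proof.
module Submission where

open import Data.List using ([]; _∷_)
open import Data.Nat using (ℕ; zero; suc; _+_; _*_; _≤_; _<_; _≤?_; _<?_; z≤n; s≤s; z<s; NonZero; ≢-nonZero⁻¹; >-nonZero⁻¹)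
open import Data.Nat.Properties
open import Data.Nat.Induction using (<-rec)
open import Data.Nat.Tactic.RingSolver using (solve)
open import Data.Integer as ℤ using (+_)
import Data.Integer.Properties as ℤ
import Data.Nat.Coprimality as Coprime
open import Data.Rational as ℚ using (mkℚ; ↥_; 0ℚ)
import Data.Rational.Properties as ℚ
open import Data.Rational.Solver using () renaming (module +-*-Solver to ℚ-Solver)
open import Algebra.Properties.AbelianGroup ℚ.+-0-abelianGroup using (xyx⁻¹≈y; x∙y⁻¹≈ε⇒x≈y)
open import Data.Product using (_×_; _,_; ∃-syntax)
open import Data.Sum using (_⊎_; inj₁; inj₂)
open import Function using (_∘_; case_of_)
open import Relation.Binary.Definitions using (tri<; tri≈; tri>)
open import Relation.Binary.PropositionalEquality using (_≡_; refl; sym; trans; cong; cong₂; subst; module ≡-Reasoning)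
open import Relation.Nullary using (yes; no; contradiction)
open import Relation.Nullary.Decidable using (from-no)
open import Defs

Solution : ℕ → ℕ → ℕ → ℕ → Set
Solution k x y z = x * y * z ≡ x * x + y * y + z * z + k

solution-rotate : ∀ {k} x y z → Solution k x y z → Solution k y z x
solution-rotate {k} x y z sol = begin
  y * z * x                 ≡⟨ solve (x ∷ y ∷ z ∷ []) ⟩
  x * y * z                 ≡⟨ sol ⟩
  x * x + y * y + z * z + k ≡⟨ solve (x ∷ y ∷ z ∷ k ∷ []) ⟩
  y * y + z * z + x * x + k ∎
  where open ≡-Reasoning

solution-swap : ∀ {k} x y z → Solution k x y z → Solution k x z y
solution-swap {k} x y z sol = begin
  x * z * y                 ≡⟨ solve (x ∷ y ∷ z ∷ []) ⟩
  x * y * z                 ≡⟨ sol ⟩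
  x * x + y * y + z * z + k ≡⟨ solve (x ∷ y ∷ z ∷ k ∷ []) ⟩
  x * x + z * z + y * y + k ∎
  where open ≡-Reasoning

solution-reverse : ∀ {k} x y z → Solution k x y z → Solution k z y x
solution-reverse x y z = solution-swap z x y ∘ solution-rotate y z x ∘ solution-rotate x y z

solution-positive : ∀ {k} .{{_ : NonZero k}} x y z → Solution k x y z → 0 < x
solution-positive {k} zero    y z sol = contradiction (m+n≡0⇒n≡0 (y * y + z * z) (sym sol)) (≢-nonZero⁻¹ k)
solution-positive     (suc x) y z sol = z<s

vieta-product : ∀ {k} x y z w → Solution k x y z → y + w ≡ x * z → y * w ≡ x * x + z * z + k
vieta-product {k} x y z w sol y+w≡xz = +-cancelˡ-≡ (y * y) _ _ (begin
  y * y + y * w             ≡⟨ solve (y ∷ w ∷ []) ⟩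
  y * (y + w)               ≡⟨ cong (y *_) y+w≡xz ⟩
  y * (x * z)               ≡⟨ solve (x ∷ y ∷ z ∷ []) ⟩
  x * y * z                 ≡⟨ sol ⟩
  x * x + y * y + z * z + k ≡⟨ solve (x ∷ y ∷ z ∷ k ∷ []) ⟩
  y * y + (x * x + z * z + k) ∎)
  where open ≡-Reasoning

solution-vieta : ∀ {k} x y z w → Solution k x y z → y + w ≡ x * z → Solution k x z w
solution-vieta {k} x y z w sol y+w≡xz = begin
  x * z * w                 ≡⟨ cong (_* w) (sym y+w≡xz) ⟩
  (y + w) * w               ≡⟨ solve (y ∷ w ∷ []) ⟩
  y * w + w * w             ≡⟨ cong (_+ w * w) (vieta-product x y z w sol y+w≡xz) ⟩
  x * x + z * z + k + w * w ≡⟨ solve (x ∷ z ∷ w ∷ k ∷ []) ⟩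
  x * x + z * z + w * w + k ∎
  where open ≡-Reasoning

solution-middle<product : ∀ {k} .{{_ : NonZero k}} x y z → Solution k x y z → y < x * z
solution-middle<product {k} x y z sol = ≰⇒> λ xz≤y → <⇒≱ y*y<xyz (xyz≤y*y xz≤y)
  where
  open ≤-Reasoning
  y*y<xyz : y * y < x * y * z
  y*y<xyz = begin-strict
    y * y                       <⟨ m<m+n (y * y) (≤-trans (>-nonZero⁻¹ k) (m≤n+m k (x * x + z * z))) ⟩
    y * y + (x * x + z * z + k) ≡⟨ solve (x ∷ y ∷ z ∷ k ∷ []) ⟩
    x * x + y * y + z * z + k   ≡⟨ sol ⟨
    x * y * z                   ∎
  xyz≤y*y : x * z ≤ y → x * y * z ≤ y * y
  xyz≤y*y xz≤y = begin
    x * y * z   ≡⟨ solve (x ∷ y ∷ z ∷ []) ⟩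
    y * (x * z) ≤⟨ *-monoʳ-≤ y xz≤y ⟩
    y * y       ∎

vieta-partner : ∀ {k} .{{_ : NonZero k}} x y z → Solution k x y z → ∃[ w ] (y + w ≡ x * z × Solution k x z w)
vieta-partner x y z sol with m≤n⇒∃[o]m+o≡n (<⇒≤ (solution-middle<product x y z sol))
... | w , y+w≡xz = w , y+w≡xz , solution-vieta x y z w sol y+w≡xz

-- For a solution (a, y, b) with Vieta partner w and b ≤ y ≤ w, put
-- y = b + d and w = b + f: the relations y + w = ab and yw = a² + b² + 7
-- become b + b + (d + f) = ab and b (d + f) + d f = a² + 7.
shifted-gap-positive : ∀ a b d f → b * (d + f) + d * f ≡ a * a + 7 → 0 < d + f
shifted-gap-positive a b zero    zero    eq
  with () ← m+n≡0⇒n≡0 (a * a) (trans (sym eq) (trans (+-identityʳ (b * 0)) (*-zeroʳ b)))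
shifted-gap-positive a b zero    (suc f) _ = z<s
shifted-gap-positive a b (suc d) f       _ = z<s

shifted-minimal-at-3 : ∀ b d f → 3 ≤ b → d ≤ f → d + f ≡ b → b * b + d * f ≡ 16 → b ≡ 4 × d ≡ 0
shifted-minimal-at-3 3 0 3 _ _ refl ()
shifted-minimal-at-3 3 1 2 _ _ refl ()
shifted-minimal-at-3 3 2 1 _ (s≤s ()) refl _
shifted-minimal-at-3 3 3 0 _ () refl _
shifted-minimal-at-3 4 0 4 _ _ refl _ = refl , refl
shifted-minimal-at-3 4 1 3 _ _ refl ()
shifted-minimal-at-3 4 2 2 _ _ refl ()
shifted-minimal-at-3 4 3 1 _ (s≤s ()) refl _
shifted-minimal-at-3 4 4 0 _ () refl _
shifted-minimal-at-3 b@(suc (suc (suc (suc (suc _))))) d f _ _ _ eq =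
  contradiction (≤-trans (*-mono-≤ 5≤b 5≤b) (≤-trans (m≤m+n (b * b) (d * f)) (≤-reflexive eq))) (from-no (25 ≤? 16))
  where
  5≤b : 5 ≤ b
  5≤b = s≤s (s≤s (s≤s (s≤s (s≤s z≤n))))

shifted-minimal : ∀ a b d f → a ≤ b → d ≤ f → b + b + (d + f) ≡ a * b → b * (d + f) + d * f ≡ a * a + 7 → a ≡ 3 × b ≡ 4 × d ≡ 0
shifted-minimal a b d f a≤b d≤f sum prod with <-cmp a 3
... | tri< a<3 _ _ = contradiction gap≤0 (<⇒≱ (shifted-gap-positive a b d f prod))
  where
  open ≤-Reasoning
  gap≤0 : d + f ≤ 0
  gap≤0 = +-cancelˡ-≤ (b + b) (d + f) 0 (begin
    b + b + (d + f) ≡⟨ sum ⟩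
    a * b           ≤⟨ *-monoˡ-≤ b (≤-pred a<3) ⟩
    2 * b           ≡⟨ solve (b ∷ []) ⟩
    b + b + 0       ∎)
... | tri≈ _ refl _ = refl , shifted-minimal-at-3 b d f a≤b d≤f gap≡b (trans (cong (λ g → b * g + d * f) (sym gap≡b)) prod)
  where
  gap≡b : d + f ≡ b
  gap≡b = +-cancelˡ-≡ (b + b) _ _ (trans sum (solve (b ∷ [])))
... | tri> _ _ 3<a = contradiction (≤-trans (*-mono-≤ 3<a 3<a) a*a≤7) (from-no (16 ≤? 7))
  where
  open ≤-Reasoning
  2b≤gap : b + b ≤ d + f
  2b≤gap = +-cancelˡ-≤ (b + b) (b + b) (d + f) (begin
    b + b + (b + b) ≡⟨ solve (b ∷ []) ⟩
    4 * b           ≤⟨ *-monoˡ-≤ b 3<a ⟩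
    a * b           ≡⟨ sum ⟨
    b + b + (d + f) ∎)
  a*a≤7 : a * a ≤ 7
  a*a≤7 = +-cancelˡ-≤ (a * a) (a * a) 7 (begin
    a * a + a * a   ≡⟨ solve (a ∷ []) ⟩
    a * (a + a)     ≤⟨ *-mono-≤ a≤b (+-mono-≤ a≤b a≤b) ⟩
    b * (b + b)     ≤⟨ *-monoʳ-≤ b 2b≤gap ⟩
    b * (d + f)     ≤⟨ m≤m+n (b * (d + f)) (d * f) ⟩
    b * (d + f) + d * f ≡⟨ prod ⟩
    a * a + 7       ∎)

vieta-minimal : ∀ a b y w → a ≤ b → b ≤ y → y ≤ w → Solution 7 a y b → y + w ≡ a * b → a ≡ 3 × b ≡ 4 × y ≡ 4
vieta-minimal a b y w a≤b b≤y y≤w sol sum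
  with m≤n⇒∃[o]m+o≡n b≤y | m≤n⇒∃[o]m+o≡n (≤-trans b≤y y≤w)
... | d , refl | f , refl =
  let a≡3 , b≡4 , d≡0 = shifted-minimal a b d f a≤b (+-cancelˡ-≤ b d f y≤w) sum′ prod′
  in  a≡3 , b≡4 , cong₂ _+_ b≡4 d≡0
  where
  open ≡-Reasoning
  sum′ : b + b + (d + f) ≡ a * b
  sum′ = begin
    b + b + (d + f)   ≡⟨ solve (b ∷ d ∷ f ∷ []) ⟩
    b + d + (b + f)   ≡⟨ sum ⟩
    a * b             ∎
  prod′ : b * (d + f) + d * f ≡ a * a + 7
  prod′ = +-cancelˡ-≡ (b * b) _ _ (begin
    b * b + (b * (d + f) + d * f) ≡⟨ solve (b ∷ d ∷ f ∷ []) ⟩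
    (b + d) * (b + f)             ≡⟨ vieta-product a (b + d) b (b + f) sol sum ⟩
    a * a + b * b + 7             ≡⟨ solve (a ∷ b ∷ []) ⟩
    b * b + (a * a + 7)           ∎)

vieta-descent : ∀ x y z w → x ≤ y → z ≤ y → Solution 7 x y z → y + w ≡ x * z →
                x + z + w < x + y + z ⊎ (x ≡ 3 × y ≡ 4 × z ≡ 4) ⊎ (x ≡ 4 × y ≡ 4 × z ≡ 3)
vieta-descent x y z w x≤y z≤y sol y+w≡xz with w <? y | ≤-total x z
... | yes w<y | _ = inj₁ (begin-strict
  x + z + w <⟨ +-monoʳ-< (x + z) w<y ⟩
  x + z + y ≡⟨ solve (x ∷ y ∷ z ∷ []) ⟩
  x + y + z ∎)
  where open ≤-Reasoning
... | no w≮y | inj₁ x≤z =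
  let x≡3 , z≡4 , y≡4 = vieta-minimal x z y w x≤z z≤y (≮⇒≥ w≮y) sol y+w≡xz
  in  inj₂ (inj₁ (x≡3 , y≡4 , z≡4))
... | no w≮y | inj₂ z≤x =
  let z≡3 , x≡4 , y≡4 = vieta-minimal z x y w z≤x x≤y (≮⇒≥ w≮y) (solution-reverse x y z sol) (trans y+w≡xz (*-comm x z))
  in  inj₂ (inj₂ (x≡4 , y≡4 , z≡3))

max-in-middle-after-rotation : ∀ (x y z : ℕ) → (x ≤ y × z ≤ y) ⊎ (y ≤ z × x ≤ z) ⊎ (z ≤ x × y ≤ x)
max-in-middle-after-rotation x y z with ≤-total x y | ≤-total y z | ≤-total z x
... | inj₁ x≤y | inj₁ y≤z | _        = inj₂ (inj₁ (y≤z , ≤-trans x≤y y≤z))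
... | inj₁ x≤y | inj₂ z≤y | _        = inj₁ (x≤y , z≤y)
... | inj₂ y≤x | _        | inj₁ z≤x = inj₂ (inj₂ (z≤x , y≤x))
... | inj₂ y≤x | _        | inj₂ x≤z = inj₂ (inj₁ (≤-trans y≤x x≤z , x≤z))

⟦⟧≡mkℚ : ∀ n → ⟦ n ⟧ ≡ mkℚ (+ n) 0 (Coprime.sym (Coprime.1-coprimeTo n))
⟦⟧≡mkℚ n = ℚ.normalize-coprime (Coprime.sym (Coprime.1-coprimeTo n))

⟦⟧-injective : ∀ {m n} → ⟦ m ⟧ ≡ ⟦ n ⟧ → m ≡ n
⟦⟧-injective {m} {n} eq = ℤ.+-injective (begin
  + m     ≡⟨ cong ↥_ (⟦⟧≡mkℚ m) ⟨
  ↥ ⟦ m ⟧ ≡⟨ cong ↥_ eq ⟩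
  ↥ ⟦ n ⟧ ≡⟨ cong ↥_ (⟦⟧≡mkℚ n) ⟩
  + n     ∎)
  where open ≡-Reasoning

⟦⟧-homo-+ : ∀ m n → ⟦ m + n ⟧ ≡ ⟦ m ⟧ ℚ.+ ⟦ n ⟧
⟦⟧-homo-+ m n = begin
  + (m + n) ℚ./ 1                     ≡⟨ ℚ./-cong (ℤ.pos-+ m n) refl ⟩
  (+ m ℤ.+ + n) ℚ./ 1                 ≡⟨ ℚ./-cong (cong₂ ℤ._+_ (ℤ.*-identityʳ (+ m)) (ℤ.*-identityʳ (+ n))) refl ⟨
  (+ m ℤ.* + 1 ℤ.+ + n ℤ.* + 1) ℚ./ 1 ≡⟨ cong₂ ℚ._+_ (⟦⟧≡mkℚ m) (⟦⟧≡mkℚ n) ⟨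
  ⟦ m ⟧ ℚ.+ ⟦ n ⟧                     ∎
  where open ≡-Reasoning

⟦⟧-homo-* : ∀ m n → ⟦ m * n ⟧ ≡ ⟦ m ⟧ ℚ.* ⟦ n ⟧
⟦⟧-homo-* m n = begin
  + (m * n) ℚ./ 1     ≡⟨ ℚ./-cong (ℤ.pos-* m n) refl ⟩
  (+ m ℤ.* + n) ℚ./ 1 ≡⟨ cong₂ ℚ._*_ (⟦⟧≡mkℚ m) (⟦⟧≡mkℚ n) ⟨
  ⟦ m ⟧ ℚ.* ⟦ n ⟧     ∎
  where open ≡-Reasoning

T̃-as-difference : ∀ a b c → T̃ a b c ≡ a ℚ.* b ℚ.* c ℚ.- (a ℚ.* a ℚ.+ b ℚ.* b ℚ.+ c ℚ.* c ℚ.+ ⟦ 7 ⟧)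
T̃-as-difference a b c = ℚ-Solver.solve 4 (λ a b c s → a :* b :* c :- a :* a :- b :* b :- c :* c :- s
                                                    := a :* b :* c :- (a :* a :+ b :* b :+ c :* c :+ s)) refl a b c ⟦ 7 ⟧
  where open ℚ-Solver using (_:*_; _:+_; _:-_; _:=_)

T̃-⟦⟧ : ∀ x y z → T̃ ⟦ x ⟧ ⟦ y ⟧ ⟦ z ⟧ ≡ ⟦ x * y * z ⟧ ℚ.- ⟦ x * x + y * y + z * z + 7 ⟧
T̃-⟦⟧ x y z = trans (T̃-as-difference ⟦ x ⟧ ⟦ y ⟧ ⟦ z ⟧) (sym (cong₂ ℚ._-_ product squares))
  where
  product : ⟦ x * y * z ⟧ ≡ ⟦ x ⟧ ℚ.* ⟦ y ⟧ ℚ.* ⟦ z ⟧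
  product = trans (⟦⟧-homo-* (x * y) z) (cong (ℚ._* ⟦ z ⟧) (⟦⟧-homo-* x y))
  squares : ⟦ x * x + y * y + z * z + 7 ⟧ ≡ ⟦ x ⟧ ℚ.* ⟦ x ⟧ ℚ.+ ⟦ y ⟧ ℚ.* ⟦ y ⟧ ℚ.+ ⟦ z ⟧ ℚ.* ⟦ z ⟧ ℚ.+ ⟦ 7 ⟧
  squares = begin
    ⟦ x * x + y * y + z * z + 7 ⟧                   ≡⟨ ⟦⟧-homo-+ (x * x + y * y + z * z) 7 ⟩
    ⟦ x * x + y * y + z * z ⟧ ℚ.+ ⟦ 7 ⟧             ≡⟨ cong (ℚ._+ ⟦ 7 ⟧) (⟦⟧-homo-+ (x * x + y * y) (z * z)) ⟩
    ⟦ x * x + y * y ⟧ ℚ.+ ⟦ z * z ⟧ ℚ.+ ⟦ 7 ⟧       ≡⟨ cong (λ s → s ℚ.+ ⟦ z * z ⟧ ℚ.+ ⟦ 7 ⟧) (⟦⟧-homo-+ (x * x) (y * y)) ⟩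
    ⟦ x * x ⟧ ℚ.+ ⟦ y * y ⟧ ℚ.+ ⟦ z * z ⟧ ℚ.+ ⟦ 7 ⟧ ≡⟨ cong₂ (λ s t → s ℚ.+ t ℚ.+ ⟦ 7 ⟧) (cong₂ ℚ._+_ (⟦⟧-homo-* x x) (⟦⟧-homo-* y y)) (⟦⟧-homo-* z z) ⟩
    ⟦ x ⟧ ℚ.* ⟦ x ⟧ ℚ.+ ⟦ y ⟧ ℚ.* ⟦ y ⟧ ℚ.+ ⟦ z ⟧ ℚ.* ⟦ z ⟧ ℚ.+ ⟦ 7 ⟧ ∎
    where open ≡-Reasoning

solution⇒T̃≡0 : ∀ x y z → Solution 7 x y z → T̃ ⟦ x ⟧ ⟦ y ⟧ ⟦ z ⟧ ≡ 0ℚ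
solution⇒T̃≡0 x y z sol = begin
  T̃ ⟦ x ⟧ ⟦ y ⟧ ⟦ z ⟧     ≡⟨ T̃-⟦⟧ x y z ⟩
  ⟦ x * y * z ⟧ ℚ.- ⟦ rhs ⟧ ≡⟨ cong (λ t → ⟦ t ⟧ ℚ.- ⟦ rhs ⟧) sol ⟩
  ⟦ rhs ⟧ ℚ.- ⟦ rhs ⟧       ≡⟨ ℚ.+-inverseʳ ⟦ rhs ⟧ ⟩
  0ℚ                        ∎
  where
  open ≡-Reasoning
  rhs = x * x + y * y + z * z + 7

T̃≡0⇒solution : ∀ x y z → T̃ ⟦ x ⟧ ⟦ y ⟧ ⟦ z ⟧ ≡ 0ℚ → Solution 7 x y z
T̃≡0⇒solution x y z T̃≡0 = ⟦⟧-injective (x∙y⁻¹≈ε⇒x≈y _ _ (trans (sym (T̃-⟦⟧ x y z)) T̃≡0))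

point : ℕ → ℕ → ℕ → ℚ³
point x y z = ⟦ x ⟧ , ⟦ y ⟧ , ⟦ z ⟧

σ̃ : ℚ³ → ℚ³
σ̃ (x , y , z) = x , z , y

α̃-point : ∀ x y z w → y + w ≡ x * z → α̃ (point x y z) ≡ point x z w
α̃-point x y z w y+w≡xz = cong (λ t → ⟦ x ⟧ , ⟦ z ⟧ , t) (begin
  ⟦ x ⟧ ℚ.* ⟦ z ⟧ ℚ.- ⟦ y ⟧  ≡⟨ cong (ℚ._- ⟦ y ⟧) (⟦⟧-homo-* x z) ⟨
  ⟦ x * z ⟧ ℚ.- ⟦ y ⟧       ≡⟨ cong (λ t → ⟦ t ⟧ ℚ.- ⟦ y ⟧) y+w≡xz ⟨
  ⟦ y + w ⟧ ℚ.- ⟦ y ⟧       ≡⟨ cong (ℚ._- ⟦ y ⟧) (⟦⟧-homo-+ y w) ⟩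
  ⟦ y ⟧ ℚ.+ ⟦ w ⟧ ℚ.- ⟦ y ⟧ ≡⟨ xyx⁻¹≈y ⟦ y ⟧ ⟦ w ⟧ ⟩
  ⟦ w ⟧                     ∎)
  where open ≡-Reasoning

σ̃α̃σ̃-inverseˡ-α̃ : ∀ p → σ̃ (α̃ (σ̃ (α̃ p))) ≡ p
σ̃α̃σ̃-inverseˡ-α̃ (x , y , z) = cong (λ t → x , t , z) (ℚ-Solver.solve 2 (λ p q → p :- (p :- q) := q) refl (x ℚ.* z) y)
  where open ℚ-Solver using (_:-_; _:=_)

posSol-point : ∀ x y z → Solution 7 x y z → PosSol (point x y z)
posSol-point x y z sol =
  x , y , z , solution-positive x y z sol , solution-positive y z x sol₁ , solution-positive z x y sol₂ ,
  refl , solution⇒T̃≡0 x y z sol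
  where
  sol₁ = solution-rotate x y z sol
  sol₂ = solution-rotate y z x sol₁

posSol-α̃ : ∀ {p} → PosSol p → PosSol (α̃ p)
posSol-α̃ (x , y , z , _ , _ , _ , refl , T̃≡0) =
  let w , y+w≡xz , sol = vieta-partner x y z (T̃≡0⇒solution x y z T̃≡0)
  in  subst PosSol (sym (α̃-point x y z w y+w≡xz)) (posSol-point x z w sol)

posSol-β̃ : ∀ {p} → PosSol p → PosSol (β̃ p)
posSol-β̃ (x , y , z , _ , _ , _ , refl , T̃≡0) = posSol-point y z x (solution-rotate x y z (T̃≡0⇒solution x y z T̃≡0))

posSol-σ̃ : ∀ {p} → PosSol p → PosSol (σ̃ p)
posSol-σ̃ (x , y , z , _ , _ , _ , refl , T̃≡0) = posSol-point x z y (solution-swap x y z (T̃≡0⇒solution x y z T̃≡0))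

posSol-α̃⁻¹ : ∀ {p} → PosSol (α̃ p) → PosSol p
posSol-α̃⁻¹ {p} h = subst PosSol (σ̃α̃σ̃-inverseˡ-α̃ p) (posSol-σ̃ (posSol-α̃ (posSol-σ̃ h)))

posSol-β̃⁻¹ : ∀ {p} → PosSol (β̃ p) → PosSol p
posSol-β̃⁻¹ h = posSol-β̃ (posSol-β̃ h)

p₀ : ℚ³
p₀ = point 3 4 4

orbit⇒posSol : ∀ {p} → Orbit p₀ p → PosSol p
orbit⇒posSol base       = posSol-point 3 4 4 refl
orbit⇒posSol (by-α o)   = posSol-α̃ (orbit⇒posSol o)
orbit⇒posSol (by-β o)   = posSol-β̃ (orbit⇒posSol o)
orbit⇒posSol (by-α⁻¹ o) = posSol-α̃⁻¹ (orbit⇒posSol o)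
orbit⇒posSol (by-β⁻¹ o) = posSol-β̃⁻¹ (orbit⇒posSol o)

OrbitBelow : ℕ → Set
OrbitBelow n = ∀ x y z → x + y + z < n → Solution 7 x y z → Orbit p₀ (point x y z)

orbit-middle-max : ∀ x y z → OrbitBelow (x + y + z) → x ≤ y → z ≤ y → Solution 7 x y z → Orbit p₀ (point x y z)
orbit-middle-max x y z ih x≤y z≤y sol =
  let w , y+w≡xz , sol′ = vieta-partner x y z sol in
  case vieta-descent x y z w x≤y z≤y sol y+w≡xz of λ where
    (inj₁ smaller)                     → by-α⁻¹ (subst (Orbit p₀) (sym (α̃-point x y z w y+w≡xz)) (ih x z w smaller sol′))
    (inj₂ (inj₁ (refl , refl , refl))) → base
    (inj₂ (inj₂ (refl , refl , refl))) → by-β base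

sum-rotate : ∀ x y z → x + y + z ≡ y + z + x
sum-rotate x y z = solve (x ∷ y ∷ z ∷ [])

orbit-by-descent : ∀ x y z → OrbitBelow (x + y + z) → Solution 7 x y z → Orbit p₀ (point x y z)
orbit-by-descent x y z ih sol with max-in-middle-after-rotation x y z
... | inj₁ (x≤y , z≤y) = orbit-middle-max x y z ih x≤y z≤y sol
... | inj₂ (inj₁ (y≤z , x≤z)) =
  by-β⁻¹ (orbit-middle-max y z x (subst OrbitBelow (sum-rotate x y z) ih) y≤z x≤z (solution-rotate x y z sol))
... | inj₂ (inj₂ (z≤x , y≤x)) =
  by-β (orbit-middle-max z x y (subst OrbitBelow (trans (sum-rotate x y z) (sum-rotate y z x)) ih) z≤x y≤x
                         (solution-rotate y z x (solution-rotate x y z sol)))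

solutions-in-orbit : ∀ n → OrbitBelow n
solutions-in-orbit = <-rec OrbitBelow λ _ ih x y z below → orbit-by-descent x y z (ih below)

posSol⇒orbit : ∀ {p} → PosSol p → Orbit p₀ p
posSol⇒orbit (x , y , z , _ , _ , _ , refl , T̃≡0) = solutions-in-orbit _ x y z ≤-refl (T̃≡0⇒solution x y z T̃≡0)

theorem3p4 : (p : ℚ³) → (Orbit (⟦ 3 ⟧ , ⟦ 4 ⟧ , ⟦ 4 ⟧) p → PosSol p) × (PosSol p → Orbit (⟦ 3 ⟧ , ⟦ 4 ⟧ , ⟦ 4 ⟧) p)
theorem3p4 p = orbit⇒posSol , posSol⇒orbit
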